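{- Let $(X,d)$ be a symmetric generalized metric space and $R$ an equivalence relation on $X$. Then the topological spaces $(UX)/R$ and $U(X/R)$ have the same underlying set, and the identity function $(UX)/R\to U(X/R)$ is continuous.
   Context: A symmetric generalized metric space $(X,d)$: $d:X\times X\to[0,\infty]$ with $d(x,x)=0$, $d(x,y)=d(y,x)$ and $d(x,z)\le d(x,y)+d(y,z)$. $U$ sends such a space to the topological space on $X$ generated by the open balls $\{y:d(x,y)<\varepsilon\}$. $(UX)/R$ is the topological quotient of $UX$ by $R$. $X/R$ is the quotient generalized metric space (coequalizer for nonexpansive maps): its points are the $R$-classes, and $d_{X/R}([x],[y])$ is the infimum of $\sum_{i=1}^nd(x_i,y_i)$ over sequences $x_1,y_1,\dots,x_n,y_n$ in $X$ with $x_1\,R\,x$, $y_i\,R\,x_{i+1}$, $y_n\,R\,y$. -}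

module Defs where

open import Data.Nat using (ℕ; zero; suc)
open import Data.Fin using (Fin; inject₁; fromℕ) renaming (zero to fzero; suc to fsuc)
open import Data.Rational using (ℚ; 0ℚ; _+_; _<_; _≤_)
open import Data.Product using (Σ; _×_; _,_; ∃)
open import Data.List using (List)
open import Data.List.Relation.Unary.All using (All)
open import Relation.Binary using (IsEquivalence)

-- A value r ∈ [0,∞] is encoded by its strict upper cut {q ∈ ℚ | r < q}:
-- an upward-closed, rounded subset of the positive rationals (∞ ↦ ∅).
-- This is a bijection [0,∞] ≅ such cuts. So a symmetric generalized metric
-- d : X × X → [0,∞] is given by the predicate  Lt x y q  :⇔  d(x,y) < q.
record GenMetric (X : Set) : Set₁ where
  field
    Lt      : X → X → ℚ → Set
    pos     : ∀ {x y q} → Lt x y q → 0ℚ < q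
    upward  : ∀ {x y q r} → Lt x y q → q ≤ r → Lt x y r
    rounded : ∀ {x y q} → Lt x y q → Σ ℚ λ r → r < q × Lt x y r
    d-refl  : ∀ {x q} → 0ℚ < q → Lt x x q
    d-sym   : ∀ {x y q} → Lt x y q → Lt y x q
    d-tri   : ∀ {x y z q r} → Lt x y q → Lt y z r → Lt x z (q + r)

sumℚ : ∀ {n} → (Fin n → ℚ) → ℚ
sumℚ {zero}  f = 0ℚ
sumℚ {suc n} f = f fzero + sumℚ (λ i → f (fsuc i))

-- The quotient generalized metric on X/R, presented on representatives:
-- QLt x y ε  :⇔  d_{X/R}([x],[y]) < ε, i.e. there is a sequence
-- x_1,y_1,…,x_n,y_n (n ≥ 1) with x_1 R x, y_i R x_{i+1}, y_n R y and
-- Σ d(x_i,y_i) < ε (witnessed by rationals q_i > d(x_i,y_i) with Σ q_i < ε).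
QLt : {X : Set} → GenMetric X → (X → X → Set) → X → X → ℚ → Set
QLt {X} D R x y ε =
  Σ ℕ λ n → Σ (Fin (suc n) → X) λ xs → Σ (Fin (suc n) → X) λ ys →
  Σ (Fin (suc n) → ℚ) λ qs →
      R (xs fzero) x
    × (∀ (i : Fin n) → R (ys (inject₁ i)) (xs (fsuc i)))
    × R (ys (fromℕ n)) y
    × (∀ i → GenMetric.Lt D (xs i) (ys i) (qs i))
    × sumℚ qs < ε

-- Openness in the topology U generated by the open balls
-- B(c,ε) = {y | d(c,y) < ε}, ε > 0: V is open iff it is a union of finite
-- intersections of balls, i.e. every point of V lies in a finite
-- intersection of balls contained in V.
GenOpen : {Y : Set} → (Y → Y → ℚ → Set) → (Y → Set) → Set
GenOpen {Y} B V =
  ∀ x → V x → Σ (List (Y × ℚ)) λ bs →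
      All (λ cε → 0ℚ < Data.Product.proj₂ cε × B (Data.Product.proj₁ cε) x (Data.Product.proj₂ cε)) bs
    × (∀ y → All (λ cε → B (Data.Product.proj₁ cε) y (Data.Product.proj₂ cε)) bs → V y)

-- Subsets of X/R are represented by R-saturated predicates on X.
Saturated : {X : Set} → (X → X → Set) → (X → Set) → Set
Saturated R P = ∀ {x y} → R x y → P x → P y

-- Open in the quotient topology (UX)/R: preimage under X → X/R is open in UX.
QuotTopOpen : {X : Set} → GenMetric X → (X → Set) → Set
QuotTopOpen D P = GenOpen (GenMetric.Lt D) P

-- Open in U(X/R): generated by the balls of the quotient metric.
QuotMetricOpen : {X : Set} → GenMetric X → (X → X → Set) → (X → Set) → Set
QuotMetricOpen D R P = GenOpen (QLt D R) P

-- Every ball of the quotient metric is open in UX: if a chain from c to x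
-- has cost ε′ < ε, appending the step x → y shows that the d-ball of radius
-- ε − ε′ around x lies in the quotient ball of radius ε around c. So each
-- basic open set of U(X/R) contains, around each of its points, a finite
-- intersection of d-balls, i.e. its preimage in X is open in UX.
module Submission where

open import Data.Nat using (zero; suc)
open import Data.Fin using (Fin; inject₁; fromℕ) renaming (zero to fzero; suc to fsuc)
open import Data.Fin.Relation.Unary.Top using (view; ‵fromℕ; ‵inj₁)
open import Data.List using (List; []; _∷_)
open import Data.List.Relation.Unary.All using (All; []; _∷_)
open import Data.Product using (Σ; _×_; _,_)
open import Data.Rational using (ℚ; 0ℚ; _+_; _-_; -_; _<_)
open import Data.Rational.Properties
  using (+-assoc; +-comm; +-identityˡ; +-identityʳ; +-inverseʳ; +-monoˡ-<; <-dense)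
open import Function using (_∘_)
open import Relation.Binary using (IsEquivalence; Reflexive)
open import Relation.Binary.PropositionalEquality
open import Defs

p<q⇒0<q-p : ∀ {p q} → p < q → 0ℚ < q - p
p<q⇒0<q-p {p} {q} p<q = subst (_< q - p) (+-inverseʳ p) (+-monoˡ-< (- p) p<q)

p+[q-p]≡q : ∀ p q → p + (q - p) ≡ q
p+[q-p]≡q p q = begin
  p + (q - p)   ≡⟨ cong (p +_) (+-comm q (- p)) ⟩
  p + (- p + q) ≡⟨ sym (+-assoc p (- p) q) ⟩
  (p - p) + q   ≡⟨ cong (_+ q) (+-inverseʳ p) ⟩
  0ℚ + q        ≡⟨ +-identityˡ q ⟩
  q             ∎
  where open ≡-Reasoning

module _ {A : Set} where

  _∷ʳ_ : ∀ {n} → (Fin n → A) → A → Fin (suc n) → A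
  _∷ʳ_ {zero}  f a _        = a
  _∷ʳ_ {suc n} f a fzero    = f fzero
  _∷ʳ_ {suc n} f a (fsuc i) = ((f ∘ fsuc) ∷ʳ a) i

  ∷ʳ-inject₁ : ∀ {n} (f : Fin n → A) a i → (f ∷ʳ a) (inject₁ i) ≡ f i
  ∷ʳ-inject₁ {suc n} f a fzero    = refl
  ∷ʳ-inject₁ {suc n} f a (fsuc i) = ∷ʳ-inject₁ (f ∘ fsuc) a i

  ∷ʳ-fromℕ : ∀ {n} (f : Fin n → A) a → (f ∷ʳ a) (fromℕ n) ≡ a
  ∷ʳ-fromℕ {zero}  f a = refl
  ∷ʳ-fromℕ {suc n} f a = ∷ʳ-fromℕ (f ∘ fsuc) a

sumℚ-∷ʳ : ∀ {n} (f : Fin n → ℚ) a → sumℚ (f ∷ʳ a) ≡ sumℚ f + a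
sumℚ-∷ʳ {zero}  f a = trans (+-identityʳ a) (sym (+-identityˡ a))
sumℚ-∷ʳ {suc n} f a = begin
  f fzero + sumℚ ((f ∘ fsuc) ∷ʳ a)  ≡⟨ cong (f fzero +_) (sumℚ-∷ʳ (f ∘ fsuc) a) ⟩
  f fzero + (sumℚ (f ∘ fsuc) + a)   ≡⟨ sym (+-assoc (f fzero) _ a) ⟩
  sumℚ f + a                        ∎
  where open ≡-Reasoning

module _ {Y : Set} where

  InBall : (Y → Y → ℚ → Set) → Y → Y × ℚ → Set
  InBall B y (c , ε) = B c y ε

  InProperBall : (Y → Y → ℚ → Set) → Y → Y × ℚ → Set
  InProperBall B y (c , ε) = 0ℚ < ε × B c y ε

  Refines : (Y → Y → ℚ → Set) → (Y → Y → ℚ → Set) → Set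
  Refines B′ B = ∀ {c x ε} → B c x ε →
    Σ (Y × ℚ) λ ball → InProperBall B′ x ball × (∀ y → InBall B′ y ball → B c y ε)

  refine-intersection : ∀ {B′ B} → Refines B′ B → ∀ {x} bs → All (InProperBall B x) bs →
    Σ (List (Y × ℚ)) λ bs′ → All (InProperBall B′ x) bs′ ×
      (∀ y → All (InBall B′ y) bs′ → All (InBall B y) bs)
  refine-intersection refines []       []              = [] , [] , λ _ _ → []
  refine-intersection refines (_ ∷ bs) ((_ , x∈b) ∷ x∈bs)
    with refines x∈b | refine-intersection refines bs x∈bs
  ... | b′ , x∈b′ , b′⊆b | bs′ , x∈bs′ , ⋂bs′⊆⋂bs =
    b′ ∷ bs′ , x∈b′ ∷ x∈bs′ , λ { y (y∈b′ ∷ y∈bs′) → b′⊆b y y∈b′ ∷ ⋂bs′⊆⋂bs y y∈bs′ }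

  GenOpen-refine : ∀ {B′ B} → Refines B′ B → ∀ {V} → GenOpen B V → GenOpen B′ V
  GenOpen-refine refines open-V x x∈V with open-V x x∈V
  ... | bs , x∈bs , ⋂bs⊆V with refine-intersection refines bs x∈bs
  ... | bs′ , x∈bs′ , ⋂bs′⊆⋂bs = bs′ , x∈bs′ , λ y y∈bs′ → ⋂bs⊆V y (⋂bs′⊆⋂bs y y∈bs′)

module _ {X : Set} (D : GenMetric X) (R : X → X → Set) where
  open GenMetric D

  QLt-rounded : ∀ {c x ε} → QLt D R c x ε → Σ ℚ λ ε′ → ε′ < ε × QLt D R c x ε′
  QLt-rounded (n , xs , ys , qs , starts , links , ends , steps , cost<ε)
    with <-dense cost<ε
  ... | ε′ , cost<ε′ , ε′<ε = ε′ , ε′<ε , (n , xs , ys , qs , starts , links , ends , steps , cost<ε′)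

  QLt-extendʳ : Reflexive R → ∀ {c x y ε q} → QLt D R c x ε → Lt x y q → QLt D R c y (ε + q)
  QLt-extendʳ R-refl {x = x} {y} {ε} {q} (n , xs , ys , qs , starts , links , ends , steps , cost<ε) x<y =
    suc n , xs ∷ʳ x , ys ∷ʳ y , qs ∷ʳ q ,
    subst (λ z → R z _) (sym (∷ʳ-inject₁ xs x fzero)) starts ,
    links′ ,
    subst (λ z → R z y) (sym (∷ʳ-fromℕ ys y)) R-refl ,
    steps′ ,
    subst (_< ε + q) (sym (sumℚ-∷ʳ qs q)) (+-monoˡ-< q cost<ε)
    where
    links′ : ∀ i → R ((ys ∷ʳ y) (inject₁ i)) ((xs ∷ʳ x) (fsuc i))
    links′ i with view i
    ... | ‵fromℕ rewrite ∷ʳ-inject₁ ys y (fromℕ n) | ∷ʳ-fromℕ xs x = ends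
    ... | ‵inj₁ {i = j} _
      rewrite ∷ʳ-inject₁ ys y (inject₁ j) | ∷ʳ-inject₁ xs x (fsuc j) = links j

    steps′ : ∀ i → Lt ((xs ∷ʳ x) i) ((ys ∷ʳ y) i) ((qs ∷ʳ q) i)
    steps′ i with view i
    ... | ‵fromℕ rewrite ∷ʳ-fromℕ xs x | ∷ʳ-fromℕ ys y | ∷ʳ-fromℕ qs q = x<y
    ... | ‵inj₁ {i = j} _
      rewrite ∷ʳ-inject₁ xs x j | ∷ʳ-inject₁ ys y j | ∷ʳ-inject₁ qs q j = steps j

  balls-refine-quotient-balls : Reflexive R → Refines Lt (QLt D R)
  balls-refine-quotient-balls R-refl {c} {x} {ε} c<x with QLt-rounded c<x
  ... | ε′ , ε′<ε , c<ε′x = (x , ε - ε′) , (δ>0 , d-refl δ>0) , ball⊆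
    where
    δ>0 : 0ℚ < ε - ε′
    δ>0 = p<q⇒0<q-p ε′<ε

    ball⊆ : ∀ y → Lt x y (ε - ε′) → QLt D R c y ε
    ball⊆ y x<y = subst (QLt D R c y) (p+[q-p]≡q ε′ ε) (QLt-extendʳ R-refl c<ε′x x<y)

lemma3p61 : (X : Set) (D : GenMetric X) (R : X → X → Set) → IsEquivalence R →
              (P : X → Set) → Saturated R P →
              QuotMetricOpen D R P → QuotTopOpen D P
lemma3p61 X D R R-equiv P _ =
  GenOpen-refine (balls-refine-quotient-balls D R (IsEquivalence.refl R-equiv))
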